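{- Let $n\geq 2$. There is a bijection $$\psi: \bigcup_{1\leq k\leq \lfloor n/2\rfloor}\mathcal{HM}_{n,k}\to \bigcup_{1\leq k\leq \lfloor n/2\rfloor}\mathcal{MP}_{n,2k}^{*U}$$ such that for each $k$, $(M,P)\in \mathcal{HM}_{n,k}$ if and only if $\psi(M,P)\in \mathcal{MP}_{n,2k}^{*U}$. Moreover, $P$ is a peak of $M$ if and only if $\psi(M,P)$ ends with an up step.
   Context: A Motzkin path of order $n$ is a lattice path from $(0,0)$ to $(n,0)$ using up steps $U=(1,1)$, down steps $D=(1,-1)$ and flat steps $F=(1,0)$ that never goes below the $x$-axis. A hump is a consecutive sequence of steps of a Motzkin path consisting of an up step, followed by zero or more flat steps, followed by a down step; a peak is a hump with no flat steps; the height of a hump is the $y$-coordinate reached by its up step. $\mathcal{HM}_{n,k}$ is the set of pairs $(M,P)$ with $M$ a Motzkin path of order $n$ and $P$ a hump of $M$ of height $k$. A Motzkin prefix is a lattice path that is a prefix of a Motzkin path (i.e. a path from $(0,0)$ with steps $U,D,F$ never going below the $x$-axis). $\mathcal{MP}_{n,k}$ is the set of Motzkin prefixes from $(0,0)$ to $(n,k)$, and $\mathcal{MP}_{n,k}^{*U}$ is the set of those $M\in\mathcal{MP}_{n,k}$ whose last non-flat step is $U$. -}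

module Defs where

open import Data.Nat using (ℕ; zero; suc; _≤_; _*_; _/_)
open import Data.Integer using (ℤ; +_; _+_; _≤_; -[1+_])
open import Data.List using (List; []; _∷_; _++_; length; take; replicate)
open import Data.List.Relation.Unary.All using (All)
open import Data.Product using (Σ; ∃; ∃-syntax; _×_; _,_; proj₁)
open import Relation.Binary.PropositionalEquality using (_≡_)

-- Steps: U = (1,1), D = (1,-1), F = (1,0)
data Step : Set where
  U D F : Step

stepVal : Step → ℤ
stepVal U = + 1
stepVal D = -[1+ 0 ]
stepVal F = + 0

ht : List Step → ℤ
ht [] = + 0
ht (x ∷ s) = stepVal x + ht s

NeverBelow : List Step → Set
NeverBelow s = ∀ i → + 0 Data.Integer.≤ ht (take i s)

IsMotzkinPath : ℕ → List Step → Set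
IsMotzkinPath n M = length M ≡ n × NeverBelow M × ht M ≡ + 0

IsMotzkinPrefix : ℕ → ℕ → List Step → Set
IsMotzkinPrefix n k M = length M ≡ n × NeverBelow M × ht M ≡ + k

LastNonFlatU : List Step → Set
LastNonFlatU M = ∃[ a ] ∃[ b ] (M ≡ a ++ U ∷ b × All (_≡ F) b)

InMPU : ℕ → ℕ → List Step → Set
InMPU n k M = IsMotzkinPrefix n k M × LastNonFlatU M

EndsWithU : List Step → Set
EndsWithU M = ∃[ a ] M ≡ a ++ U ∷ []

-- A hump of M is specified by (i , m): the up step is step number i (0-based,
-- i.e. preceded by i steps), followed by m flat steps and then a down step.
IsHump : List Step → ℕ → ℕ → Set
IsHump M i m = ∃[ a ] ∃[ b ] (length a ≡ i × M ≡ a ++ (U ∷ replicate m F ++ D ∷ b))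

humpHeight : List Step → ℕ → ℤ
humpHeight M i = ht (take (suc i) M)

-- raw data of a pair (M , P): the path and the hump (position, number of flats)
HMData : Set
HMData = List Step × ℕ × ℕ

InHM : ℕ → ℕ → HMData → Set
InHM n k (M , i , m) = IsMotzkinPath n M × IsHump M i m × humpHeight M i ≡ + k

IsPeak : HMData → Set
IsPeak (M , i , m) = m ≡ 0

HMUnion : ℕ → Set
HMUnion n = Σ HMData λ x → ∃[ k ] (1 Data.Nat.≤ k × k Data.Nat.≤ n / 2 × InHM n k x)

MPUnion : ℕ → Set
MPUnion n = Σ (List Step) λ M → ∃[ k ] (1 Data.Nat.≤ k × k Data.Nat.≤ n / 2 × InMPU n (2 * k) M)

{-# OPTIONS --safe #-}
-- Cut M at the up step of P: M = a U t with t = F^m D b, and let ψ(M, P) = a U t̄, where t̄ is t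
-- read backwards with U and D exchanged. If P has height k, then a ends at height k - 1 and t
-- descends from k to 0, so t̄ climbs from 0 to k and a U t̄ is a Motzkin prefix ending at height 2k
-- that stays at height ≥ k after the cut. Its last non-flat step is the mirror image of the down
-- step of P, followed by the m flat steps of P, so it ends with U iff P is a peak. Conversely, a
-- prefix ending at 2k crosses from height k - 1 to k by up steps, and only the last such crossing
-- is a cut of this shape: in the mirror image it is the first descent from k to k - 1.
module Submission where

open import Defs
open import Data.Nat using (ℕ; _≤_; _*_; _/_)
open import Data.Product using (Σ; ∃; ∃-syntax; _×_; _,_; proj₁)
open import Function.Bundles using (_⇔_)
open import Relation.Binary.PropositionalEquality using (_≡_)

open import Data.Nat using (zero; suc; _+_; z≤n)
open import Data.Nat.Properties using (+-comm; +-identityʳ; suc-injective; *-cancelˡ-≡; n≮n; m+n≤o⇒n≤o)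
open import Data.Integer as ℤ using (+_; -[1+_]; +≤+)
import Data.Integer.Properties as ℤₚ
open import Data.List using (List; []; _∷_; _++_; _∷ʳ_; length; take; replicate; reverse; map)
open import Data.List.Properties
  using (++-assoc; length-++; length-map; length-reverse; map-++; map-∘; map-cong; map-id;
         reverse-++; reverse-map; reverse-involutive; ∷-injectiveʳ; ∷ʳ-injectiveʳ)
open import Data.List.Relation.Unary.All using (All; []; _∷_)
open import Data.List.Relation.Unary.All.Properties using (replicate⁺)
open import Data.Product using (∃₂; proj₂; map₁; map₂; swap)
open import Data.Empty using (⊥-elim)
open import Function.Bundles using (mk⇔)
open import Relation.Nullary using (contradiction)
open import Relation.Binary.PropositionalEquality using (refl; sym; trans; cong; subst; module ≡-Reasoning)
open ≡-Reasoning

variable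
  n k h h′ h″ c o e m : ℕ
  a a′ s s′ t t′ x x′ y y′ W : List Step

-- Path h s h′ : the steps s lead from height h to height h′ without going below the x-axis.
data Path : ℕ → List Step → ℕ → Set where
  []   : Path h [] h
  up   : Path (suc h) s h′ → Path h (U ∷ s) h′
  flat : Path h s h′ → Path h (F ∷ s) h′
  down : Path h s h′ → Path (suc h) (D ∷ s) h′

+-up : ∀ h z → + h ℤ.+ (+ 1 ℤ.+ z) ≡ + suc h ℤ.+ z
+-up h z = trans (sym (ℤₚ.+-assoc (+ h) (+ 1) z)) (cong (λ i → + i ℤ.+ z) (+-comm h 1))

+-flat : ∀ h z → + h ℤ.+ (+ 0 ℤ.+ z) ≡ + h ℤ.+ z
+-flat h z = cong (λ w → + h ℤ.+ w) (ℤₚ.+-identityˡ z)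

+-down : ∀ h z → + suc h ℤ.+ (-[1+ 0 ] ℤ.+ z) ≡ + h ℤ.+ z
+-down h z = sym (ℤₚ.+-assoc (+ suc h) -[1+ 0 ] z)

Path-ht : Path h s h′ → + h ℤ.+ ht s ≡ + h′
Path-ht {h = h} [] = ℤₚ.+-identityʳ (+ h)
Path-ht {h = h}     {s = U ∷ s} (up p)   = trans (+-up h (ht s)) (Path-ht p)
Path-ht {h = h}     {s = F ∷ s} (flat p) = trans (+-flat h (ht s)) (Path-ht p)
Path-ht {h = suc h} {s = D ∷ s} (down p) = trans (+-down h (ht s)) (Path-ht p)

Path-ht₀ : Path 0 s k → ht s ≡ + k
Path-ht₀ p = trans (sym (ℤₚ.+-identityˡ _)) (Path-ht p)

Path-take : Path h s h′ → ∀ i → ∃[ h″ ] Path h (take i s) h″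
Path-take _        zero    = _ , []
Path-take []       (suc i) = _ , []
Path-take (up p)   (suc i) = map₂ up (Path-take p i)
Path-take (flat p) (suc i) = map₂ flat (Path-take p i)
Path-take (down p) (suc i) = map₂ down (Path-take p i)

Path-nonneg : Path h s h′ → ∀ i → + 0 ℤ.≤ + h ℤ.+ ht (take i s)
Path-nonneg p i = subst (+ 0 ℤ.≤_) (sym (Path-ht (proj₂ (Path-take p i)))) (+≤+ z≤n)

nonneg⇒Path : ∀ h s → (∀ i → + 0 ℤ.≤ + h ℤ.+ ht (take i s)) → ∃[ h′ ] Path h s h′
nonneg⇒Path h []      _      = h , []
nonneg⇒Path h (U ∷ s) nonneg = map₂ up (nonneg⇒Path (suc h) s (λ i → subst (+ 0 ℤ.≤_) (+-up h (ht (take i s))) (nonneg (suc i))))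
nonneg⇒Path h (F ∷ s) nonneg = map₂ flat (nonneg⇒Path h s (λ i → subst (+ 0 ℤ.≤_) (+-flat h (ht (take i s))) (nonneg (suc i))))
nonneg⇒Path zero    (D ∷ s) nonneg with nonneg 1
... | ()
nonneg⇒Path (suc h) (D ∷ s) nonneg = map₂ down (nonneg⇒Path h s (λ i → subst (+ 0 ℤ.≤_) (+-down h (ht (take i s))) (nonneg (suc i))))

IsMotzkinPrefix⇒Path : IsMotzkinPrefix n k s → Path 0 s k
IsMotzkinPrefix⇒Path {s = s} (_ , neverBelow , htk)
  with nonneg⇒Path 0 s (λ i → subst (+ 0 ℤ.≤_) (sym (ℤₚ.+-identityˡ _)) (neverBelow i))
... | _ , p with ℤₚ.+-injective (trans (sym (Path-ht₀ p)) htk)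
... | refl = p

Path⇒IsMotzkinPrefix : length s ≡ n → Path 0 s k → IsMotzkinPrefix n k s
Path⇒IsMotzkinPrefix len p = len , (λ i → subst (+ 0 ℤ.≤_) (ℤₚ.+-identityˡ _) (Path-nonneg p i)) , Path-ht₀ p

Path-++⁺ : Path h s h′ → Path h′ t h″ → Path h (s ++ t) h″
Path-++⁺ []       q = q
Path-++⁺ (up p)   q = up (Path-++⁺ p q)
Path-++⁺ (flat p) q = flat (Path-++⁺ p q)
Path-++⁺ (down p) q = down (Path-++⁺ p q)

Path-++⁻ : ∀ s → Path h (s ++ t) h″ → ∃[ h′ ] Path h s h′ × Path h′ t h″
Path-++⁻ []      p        = _ , [] , p
Path-++⁻ (U ∷ s) (up p)   = map₂ (map₁ up) (Path-++⁻ s p)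
Path-++⁻ (F ∷ s) (flat p) = map₂ (map₁ flat) (Path-++⁻ s p)
Path-++⁻ (D ∷ s) (down p) = map₂ (map₁ down) (Path-++⁻ s p)

Path-shift : ∀ o → Path h s h′ → Path (h + o) s (h′ + o)
Path-shift o []       = []
Path-shift o (up p)   = up (Path-shift o p)
Path-shift o (flat p) = flat (Path-shift o p)
Path-shift o (down p) = down (Path-shift o p)

Path-flats : ∀ m → Path h (replicate m F) h
Path-flats zero    = []
Path-flats (suc m) = flat (Path-flats m)

Path-flats⁻ : ∀ m → Path h (replicate m F) h′ → h ≡ h′
Path-flats⁻ zero    []       = refl
Path-flats⁻ (suc m) (flat p) = Path-flats⁻ m p

opposite : Step → Step
opposite U = D
opposite D = U
opposite F = F

opposite-involutive : ∀ x → opposite (opposite x) ≡ x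
opposite-involutive U = refl
opposite-involutive D = refl
opposite-involutive F = refl

mirror : List Step → List Step
mirror s = reverse (map opposite s)

mirror-++ : ∀ s t → mirror (s ++ t) ≡ mirror t ++ mirror s
mirror-++ s t = trans (cong reverse (map-++ opposite s t)) (reverse-++ (map opposite s) (map opposite t))

mirror-∷ : ∀ x s → mirror (x ∷ s) ≡ mirror s ∷ʳ opposite x
mirror-∷ x s = mirror-++ (x ∷ []) s

mirror-++-∷ : ∀ s x t → mirror (s ++ x ∷ t) ≡ mirror t ++ opposite x ∷ mirror s
mirror-++-∷ s x t = begin
  mirror (s ++ x ∷ t)                   ≡⟨ mirror-++ s (x ∷ t) ⟩
  mirror (x ∷ t) ++ mirror s            ≡⟨ cong (_++ mirror s) (mirror-∷ x t) ⟩
  (mirror t ∷ʳ opposite x) ++ mirror s  ≡⟨ ++-assoc (mirror t) (opposite x ∷ []) (mirror s) ⟩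
  mirror t ++ opposite x ∷ mirror s     ∎

mirror-involutive : ∀ s → mirror (mirror s) ≡ s
mirror-involutive s = begin
  reverse (map opposite (reverse (map opposite s)))  ≡⟨ cong reverse (reverse-map opposite (map opposite s)) ⟩
  reverse (reverse (map opposite (map opposite s)))  ≡⟨ reverse-involutive _ ⟩
  map opposite (map opposite s)                      ≡⟨ map-∘ s ⟨
  map (λ x → opposite (opposite x)) s                ≡⟨ map-cong opposite-involutive s ⟩
  map (λ x → x) s                                    ≡⟨ map-id s ⟩
  s                                                  ∎

mirror-injective : mirror s ≡ mirror t → s ≡ t
mirror-injective {s = s} {t = t} eq = begin
  s                  ≡⟨ mirror-involutive s ⟨
  mirror (mirror s)  ≡⟨ cong mirror eq ⟩
  mirror (mirror t)  ≡⟨ mirror-involutive t ⟩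
  t                  ∎

length-mirror : ∀ s → length (mirror s) ≡ length s
length-mirror s = trans (length-reverse (map opposite s)) (length-map opposite s)

replicate-∷ʳ : ∀ {A : Set} m (x : A) → replicate m x ∷ʳ x ≡ x ∷ replicate m x
replicate-∷ʳ zero    x = refl
replicate-∷ʳ (suc m) x = cong (x ∷_) (replicate-∷ʳ m x)

mirror-flats : ∀ m → mirror (replicate m F) ≡ replicate m F
mirror-flats zero    = refl
mirror-flats (suc m) = begin
  mirror (F ∷ replicate m F)    ≡⟨ mirror-∷ F (replicate m F) ⟩
  mirror (replicate m F) ∷ʳ F   ≡⟨ cong (_∷ʳ F) (mirror-flats m) ⟩
  replicate m F ∷ʳ F            ≡⟨ replicate-∷ʳ m F ⟩
  F ∷ replicate m F             ∎

Path-mirror : Path h s h′ → Path h′ (mirror s) h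
Path-mirror []                   = []
Path-mirror {s = U ∷ s} (up p)   rewrite mirror-∷ U s = Path-++⁺ (Path-mirror p) (down [])
Path-mirror {s = F ∷ s} (flat p) rewrite mirror-∷ F s = Path-++⁺ (Path-mirror p) (flat [])
Path-mirror {s = D ∷ s} (down p) rewrite mirror-∷ D s = Path-++⁺ (Path-mirror p) (up [])

-- The first step of s from height o + 1 down to o splits s as x D y; Path c x 0 says that x
-- stays at height ≥ o + 1, with heights counted from o + 1.
first-descent : ∀ c → Path (c + suc o) s e → e ≤ o →
  ∃₂ λ x y → s ≡ x ++ D ∷ y × Path c x 0 × Path o y e
first-descent zero (down p) _ = [] , _ , refl , [] , p
first-descent (suc c) (down p) e≤o with first-descent c p e≤o
... | x , y , refl , px , py = D ∷ x , y , refl , down px , py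
first-descent {o = o} c [] e≤o = ⊥-elim (n≮n o (m+n≤o⇒n≤o c e≤o))
first-descent c (up p) e≤o with first-descent (suc c) p e≤o
... | x , y , refl , px , py = U ∷ x , y , refl , up px , py
first-descent c (flat p) e≤o with first-descent c p e≤o
... | x , y , refl , px , py = F ∷ x , y , refl , flat px , py

first-descent-unique : Path c x 0 → Path c x′ 0 → x ++ D ∷ y ≡ x′ ++ D ∷ y′ → x ≡ x′ × y ≡ y′
first-descent-unique []       []        refl = refl , refl
first-descent-unique (up p)   (up p′)   eq   = map₁ (cong (U ∷_)) (first-descent-unique p p′ (∷-injectiveʳ eq))
first-descent-unique (flat p) (flat p′) eq   = map₁ (cong (F ∷_)) (first-descent-unique p p′ (∷-injectiveʳ eq))
first-descent-unique (down p) (down p′) eq   = map₁ (cong (D ∷_)) (first-descent-unique p p′ (∷-injectiveʳ eq))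
first-descent-unique []       (up _)    ()
first-descent-unique []       (flat _)  ()
first-descent-unique (up _)   []        ()
first-descent-unique (up _)   (flat _)  ()
first-descent-unique (up _)   (down _)  ()
first-descent-unique (flat _) []        ()
first-descent-unique (flat _) (up _)    ()
first-descent-unique (flat _) (down _)  ()
first-descent-unique (down _) (up _)    ()
first-descent-unique (down _) (flat _)  ()

last-ascent : ∀ c → Path 0 s (c + suc o) → ∃₂ λ a x → s ≡ a ++ U ∷ mirror x × Path 0 a o × Path c x 0
last-ascent {s = s} c p with first-descent c (Path-mirror p) z≤n
... | x , y , eq , px , py = mirror y , x , s≡ , Path-mirror py , px
  where
  s≡ : s ≡ mirror y ++ U ∷ mirror x
  s≡ = begin
    s                    ≡⟨ mirror-involutive s ⟨
    mirror (mirror s)    ≡⟨ cong mirror eq ⟩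
    mirror (x ++ D ∷ y)  ≡⟨ mirror-++-∷ x D y ⟩
    mirror y ++ U ∷ mirror x ∎

two-*-suc : ∀ k → suc (k + suc k) ≡ 2 * suc k
two-*-suc k = cong (λ j → suc (k + suc j)) (sym (+-identityʳ k))

take-suc-length : ∀ {A : Set} (a : List A) z t → take (suc (length a)) (a ++ z ∷ t) ≡ a ∷ʳ z
take-suc-length []      z t = refl
take-suc-length (w ∷ a) z t = cong (w ∷_) (take-suc-length a z t)

humpHeight-++ : Path 0 a h → humpHeight (a ++ U ∷ t) (length a) ≡ + suc h
humpHeight-++ {a = a} {t = t} pa = trans (cong ht (take-suc-length a U t)) (Path-ht₀ (Path-++⁺ pa (up [])))

hump-decomposition : IsMotzkinPath n (a ++ U ∷ t) → humpHeight (a ++ U ∷ t) (length a) ≡ + k →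
  ∃[ h ] k ≡ suc h × Path 0 a h × Path (suc h) t 0
hump-decomposition {a = a} motzkin height with Path-++⁻ a (IsMotzkinPrefix⇒Path motzkin)
... | h , pa , up pt = h , ℤₚ.+-injective (trans (sym height) (humpHeight-++ pa)) , pa , pt

mirrorAfter : List Step → List Step → List Step
mirrorAfter a t = a ++ U ∷ mirror t

length-mirrorAfter : ∀ a t → length (mirrorAfter a t) ≡ length (a ++ U ∷ t)
length-mirrorAfter a t = begin
  length (a ++ U ∷ mirror t)           ≡⟨ length-++ a ⟩
  length a + suc (length (mirror t))   ≡⟨ cong (λ l → length a + suc l) (length-mirror t) ⟩
  length a + suc (length t)            ≡⟨ length-++ a ⟨
  length (a ++ U ∷ t)                  ∎

mirror-mirrorAfter : ∀ a t → mirror (mirrorAfter a t) ≡ t ++ D ∷ mirror a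
mirror-mirrorAfter a t = trans (mirror-++-∷ a U (mirror t)) (cong (_++ D ∷ mirror a) (mirror-involutive t))

mirrorAfter-hump : ∀ a m b → mirrorAfter a (replicate m F ++ D ∷ b) ≡ (a ++ U ∷ mirror b) ++ U ∷ replicate m F
mirrorAfter-hump a m b = begin
  a ++ U ∷ mirror (replicate m F ++ D ∷ b)      ≡⟨ cong (λ r → a ++ U ∷ r) (mirror-++-∷ (replicate m F) D b) ⟩
  a ++ U ∷ mirror b ++ U ∷ mirror (replicate m F) ≡⟨ cong (λ r → a ++ U ∷ mirror b ++ U ∷ r) (mirror-flats m) ⟩
  a ++ U ∷ mirror b ++ U ∷ replicate m F        ≡⟨ ++-assoc a (U ∷ mirror b) (U ∷ replicate m F) ⟨
  (a ++ U ∷ mirror b) ++ U ∷ replicate m F      ∎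

Path-mirrorAfter : Path 0 a h → Path (suc h) t 0 → Path 0 (mirrorAfter a t) (2 * suc h)
Path-mirrorAfter {h = h} pa pt =
  Path-++⁺ pa (subst (Path h _) (two-*-suc h) (up (Path-shift (suc h) (Path-mirror pt))))

mirrorAfter-injective : Path c t 0 → Path c t′ 0 → mirrorAfter a t ≡ mirrorAfter a′ t′ → a ≡ a′ × t ≡ t′
mirrorAfter-injective {t = t} {t′ = t′} {a = a} {a′ = a′} pt pt′ eq =
  swap (map₂ mirror-injective (first-descent-unique pt pt′ mirrored))
  where
  mirrored : t ++ D ∷ mirror a ≡ t′ ++ D ∷ mirror a′
  mirrored = trans (sym (mirror-mirrorAfter a t)) (trans (cong mirror eq) (mirror-mirrorAfter a′ t′))

flats-D-injective : ∀ m m′ → replicate m F ++ D ∷ s ≡ replicate m′ F ++ D ∷ s′ → m ≡ m′ × s ≡ s′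
flats-D-injective zero    zero     refl = refl , refl
flats-D-injective (suc m) (suc m′) eq   = map₁ (cong suc) (flats-D-injective m m′ (∷-injectiveʳ eq))
flats-D-injective zero    (suc _)  ()
flats-D-injective (suc _) zero     ()

all-F⇒flats : All (_≡ F) s → s ≡ replicate (length s) F
all-F⇒flats []           = refl
all-F⇒flats (refl ∷ all) = cong (F ∷_) (all-F⇒flats all)

lastNonFlatU⇒flats : LastNonFlatU W → ∃₂ λ a m → W ≡ a ++ U ∷ replicate m F
lastNonFlatU⇒flats (a , b , refl , flats) = a , length b , cong (λ r → a ++ U ∷ r) (all-F⇒flats flats)

lastNonFlatU-flats : ∀ a m → LastNonFlatU (a ++ U ∷ replicate m F)
lastNonFlatU-flats a m = a , replicate m F , refl , replicate⁺ m refl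

endsWithU-flats : ∀ a m → m ≡ 0 ⇔ EndsWithU (a ++ U ∷ replicate m F)
endsWithU-flats a m = mk⇔ (λ { refl → a , refl }) (ends-with-U m)
  where
  ends-with-U : ∀ m → EndsWithU (a ++ U ∷ replicate m F) → m ≡ 0
  ends-with-U zero    _        = refl
  ends-with-U (suc m) (a′ , eq) = contradiction (∷ʳ-injectiveʳ (a ++ U ∷ replicate m F) a′ (trans ends-with-F eq)) λ ()
    where
    ends-with-F : (a ++ U ∷ replicate m F) ∷ʳ F ≡ a ++ U ∷ F ∷ replicate m F
    ends-with-F = trans (++-assoc a (U ∷ replicate m F) (F ∷ [])) (cong (λ r → a ++ U ∷ r) (replicate-∷ʳ m F))

humpMirror : ∀ {n k d} → InHM n k d → List Step
humpMirror {d = _ , _ , m} (_ , (a , b , _) , _) = mirrorAfter a (replicate m F ++ D ∷ b)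

InHM-level-unique : ∀ {n k k′ d} → InHM n k d → InHM n k′ d → k ≡ k′
InHM-level-unique (_ , _ , height) (_ , _ , height′) = ℤₚ.+-injective (trans (sym height) height′)

InMPU-level-unique : ∀ {k k′} → InMPU n (2 * k) W → InMPU n (2 * k′) W → k ≡ k′
InMPU-level-unique {k = k} {k′ = k′} ((_ , _ , htW) , _) ((_ , _ , htW′) , _) =
  *-cancelˡ-≡ k k′ 2 (ℤₚ.+-injective (trans (sym htW) htW′))

humpMirror-InMPU : ∀ {n k d} (hm : InHM n k d) → InMPU n (2 * k) (humpMirror hm)
humpMirror-InMPU {d = _ , _ , m} (motzkin , (a , b , refl , refl) , height)
  with hump-decomposition motzkin height
... | _ , refl , pa , pt =
  Path⇒IsMotzkinPrefix (trans (length-mirrorAfter a _) (proj₁ motzkin)) (Path-mirrorAfter pa pt) ,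
  subst LastNonFlatU (sym (mirrorAfter-hump a m b)) (lastNonFlatU-flats (a ++ U ∷ mirror b) m)

humpMirror-injective : ∀ {n k k′ d d′} (hm : InHM n k d) (hm′ : InHM n k′ d′) →
  humpMirror hm ≡ humpMirror hm′ → d ≡ d′
humpMirror-injective {k = k} {k′ = k′}
  hm@(motzkin , (_ , _ , refl , refl) , height) hm′@(motzkin′ , (_ , _ , refl , refl) , height′) eq
  with InMPU-level-unique {k = k} {k′ = k′} (humpMirror-InMPU hm) (subst (InMPU _ _) (sym eq) (humpMirror-InMPU hm′))
... | refl with hump-decomposition motzkin height | hump-decomposition motzkin′ height′
... | _ , refl , _ , pt | _ , refl , _ , pt′ with mirrorAfter-injective pt pt′ eq
... | refl , tails with flats-D-injective _ _ tails
... | refl , refl = refl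

humpMirror-surjective : 1 ≤ k → InMPU n (2 * k) W → ∃[ d ] Σ (InHM n k d) λ hm → humpMirror hm ≡ W
humpMirror-surjective {k = suc k} {n = n} _ (prefix , lastU) with lastNonFlatU⇒flats lastU
... | a₀ , m , refl with Path-++⁻ a₀ (IsMotzkinPrefix⇒Path prefix)
... | _ , pa₀ , up pflats with suc-injective (trans (Path-flats⁻ m pflats) (sym (two-*-suc k)))
... | refl with last-ascent k pa₀
... | a , b , refl , pa , pb =
  (a ++ U ∷ replicate m F ++ D ∷ b , length a , m) ,
  (motzkin , (a , b , refl , refl) , humpHeight-++ pa) ,
  mirrorAfter-hump a m b
  where
  motzkin : IsMotzkinPath n (a ++ U ∷ replicate m F ++ D ∷ b)
  motzkin = Path⇒IsMotzkinPrefix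
    (trans (sym (length-mirrorAfter a _)) (trans (cong length (mirrorAfter-hump a m b)) (proj₁ prefix)))
    (Path-++⁺ pa (up (Path-++⁺ (Path-flats m) (down pb))))

humpMirror-level : ∀ {n k₀ k d} (hm : InHM n k₀ d) → InHM n k d ⇔ InMPU n (2 * k) (humpMirror hm)
humpMirror-level {n = n} {d = d} hm = mk⇔
  (λ hm′ → subst (λ j → InMPU n (2 * j) (humpMirror hm)) (InHM-level-unique hm hm′) (humpMirror-InMPU hm))
  (λ mpu → subst (λ j → InHM n j d) (InMPU-level-unique (humpMirror-InMPU hm) mpu) hm)

humpMirror-peak : ∀ {n k d} (hm : InHM n k d) → IsPeak d ⇔ EndsWithU (humpMirror hm)
humpMirror-peak {d = _ , _ , m} (_ , (a , b , _) , _) =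
  subst (λ W → m ≡ 0 ⇔ EndsWithU W) (sym (mirrorAfter-hump a m b)) (endsWithU-flats (a ++ U ∷ mirror b) m)

-- For n < 2 both unions are empty.
lemma2p1 : (n : ℕ) → 2 ≤ n →
    Σ (HMUnion n → MPUnion n) λ ψ →
      ((x y : HMUnion n) → proj₁ (ψ x) ≡ proj₁ (ψ y) → proj₁ x ≡ proj₁ y)
      × ((y : MPUnion n) → ∃[ x ] (proj₁ (ψ x) ≡ proj₁ y))
      × ((x : HMUnion n) → (k : ℕ) → 1 ≤ k → k ≤ n / 2 →
          (InHM n k (proj₁ x) ⇔ InMPU n (2 * k) (proj₁ (ψ x))))
      × ((x : HMUnion n) → (IsPeak (proj₁ x) ⇔ EndsWithU (proj₁ (ψ x))))
lemma2p1 n _ = ψ , ψ-injective , ψ-surjective , ψ-level , ψ-peak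
  where
  ψ : HMUnion n → MPUnion n
  ψ (_ , k , 1≤k , k≤n/2 , hm) = humpMirror hm , k , 1≤k , k≤n/2 , humpMirror-InMPU hm

  ψ-injective : (x y : HMUnion n) → proj₁ (ψ x) ≡ proj₁ (ψ y) → proj₁ x ≡ proj₁ y
  ψ-injective (_ , _ , _ , _ , hm) (_ , _ , _ , _ , hm′) = humpMirror-injective hm hm′

  ψ-surjective : (y : MPUnion n) → ∃[ x ] (proj₁ (ψ x) ≡ proj₁ y)
  ψ-surjective (_ , k , 1≤k , k≤n/2 , mpu) =
    let d , hm , ψ≡ = humpMirror-surjective 1≤k mpu in (d , k , 1≤k , k≤n/2 , hm) , ψ≡

  ψ-level : (x : HMUnion n) → (k : ℕ) → 1 ≤ k → k ≤ n / 2 →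
    (InHM n k (proj₁ x) ⇔ InMPU n (2 * k) (proj₁ (ψ x)))
  ψ-level (_ , _ , _ , _ , hm) _ _ _ = humpMirror-level hm

  ψ-peak : (x : HMUnion n) → (IsPeak (proj₁ x) ⇔ EndsWithU (proj₁ (ψ x)))
  ψ-peak (_ , _ , _ , _ , hm) = humpMirror-peak hm
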